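{- There exist no $x\in D$ and $i,j\in\mathbb{Z}_{q^2+1}$ such that $0,i,j,2i,2j$ are five distinct elements with $\{0,i,j,2i,2j\}\subseteq C_x$.
   Context: $q$ is an odd prime power, $\alpha$ a primitive element of $\mathbb{F}_{q^4}$, $\mathrm{Tr}(a)=a+a^q+a^{q^2}+a^{q^3}$. Let $n=(q^2+1)(q+1)$, $D=\{i\in\mathbb{Z}_n:\mathrm{Tr}(\alpha^i)=0\}$. For $x\in D$, $C_x=\{i\in\mathbb{Z}_{q^2+1}:\mathrm{Tr}(\alpha^{x+(q+1)i})=0\}$; arithmetic is modulo $q^2+1$. -}

module Defs where

open import Level using (Level; _⊔_) renaming (suc to lsuc)
open import Data.Nat using (ℕ; suc; _<_; _≤_; _%_) renaming (_+_ to _+ℕ_; _*_ to _*ℕ_; _∸_ to _∸ℕ_; _^_ to _^ℕ_)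
open import Data.Nat.Primality using (Prime)
open import Data.Product using (Σ; ∃; _×_; _,_)
open import Data.List using (List; length)
open import Data.List.Relation.Unary.Any using (Any)
open import Relation.Nullary using (¬_)
open import Relation.Binary.PropositionalEquality using (_≡_)
open import Algebra.Bundles using (CommutativeRing; Semiring)
import Data.List.Relation.Unary.Unique.Setoid as UniqueS
import Algebra.Definitions.RawSemiring as RS

IsOddPrimePower : ℕ → Set
IsOddPrimePower q = Σ ℕ λ p → Σ ℕ λ k → Prime p × (p % 2 ≡ 1) × (1 ≤ k) × (q ≡ p ^ℕ k)

record FiniteField (c ℓ : Level) (N : ℕ) : Set (lsuc (c ⊔ ℓ)) where
  field
    commRing : CommutativeRing c ℓ
  open CommutativeRing commRing public
  field
    0≉1      : ¬ (0# ≈ 1#)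
    inverse  : ∀ x → ¬ (x ≈ 0#) → ∃ λ y → (x * y) ≈ 1#
    elems    : List Carrier
    unique   : UniqueS.Unique setoid elems
    complete : ∀ x → Any (x ≈_) elems
    size     : length elems ≡ N
  open RS (Semiring.rawSemiring semiring) public using () renaming (_^_ to _^ᶠ_)

module _ {c ℓ : Level} {N : ℕ} (F : FiniteField c ℓ N) where
  open FiniteField F

  IsPrimitive : Carrier → Set ℓ
  IsPrimitive α = ((α ^ᶠ (N ∸ℕ 1)) ≈ 1#) × (∀ m → 0 < m → m < N ∸ℕ 1 → ¬ ((α ^ᶠ m) ≈ 1#))

-- modulus q^2+1 of Z_{q^2+1}, written as suc (q^2) so that it is visibly nonzero
m₂ : ℕ → ℕ
m₂ q = suc (q ^ℕ 2)

twice : ℕ → ℕ → ℕ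
twice q i = (2 *ℕ i) % m₂ q

module _ {c ℓ : Level} (q : ℕ) (F : FiniteField c ℓ (q ^ℕ 4)) where
  open FiniteField F

  Tr : Carrier → Carrier
  Tr a = a + (a ^ᶠ q) + (a ^ᶠ (q ^ℕ 2)) + (a ^ᶠ (q ^ℕ 3))

  nD : ℕ
  nD = m₂ q *ℕ (q +ℕ 1)

  -- x ∈ D  (x ∈ Z_n represented by 0 ≤ x < n)
  InD : Carrier → ℕ → Set ℓ
  InD α x = (x < nD) × (Tr (α ^ᶠ x) ≈ 0#)

  -- i ∈ C_x  (i ∈ Z_{q^2+1} represented by 0 ≤ i < q^2+1)
  InC : Carrier → ℕ → ℕ → Set ℓ
  InC α x i = (i < m₂ q) × (Tr (α ^ᶠ (x +ℕ (q +ℕ 1) *ℕ i)) ≈ 0#)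

{-# OPTIONS --safe #-}
-- Put u = α^x and v = α^((q+1)k). Then Tr(u vᵗ) = Σₑ u^(qᵉ) (v^(qᵉ))ᵗ is a power sum in the four
-- conjugates of v, and v·v^(q²) ∈ F_q. If Tr vanishes at u, uv and uv², eliminating with the polynomial
-- (t - v^q)(t - v^(q³)) leaves (v - v^q)(v - v^(q³))(uv + (uv)^(q²)) = 0. For 0 < k < q²+1 primitivity
-- of α gives v ≠ v^q, v^(q³), so 0, k, 2k ∈ C_x force the trace of α^(x+(q+1)k) to F_{q²} to vanish.
-- Doing so for k = i and k = j, the quotient w = α^((q+1)(i-j)) satisfies w^(q²) = w, hence q⁴ - 1
-- divides (q+1)(i-j)(q²-1): q²+1 divides (q+1)(i-j) and therefore 2(i-j), i.e. 2i = 2j in Z_{q²+1}.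
module Submission where

open import Defs
open import Level using (Level; _⊔_)
open import Data.Nat using (ℕ; _<_; _^_)
open import Data.Product using (Σ; _×_)
open import Relation.Nullary using (¬_)
open import Relation.Binary.PropositionalEquality using (_≢_)

open import Algebra.Bundles using (CommutativeRing)
open import Data.Empty using (⊥-elim)
open import Data.Nat using (zero; suc; pred; _≤_; s≤s; NonZero) renaming (_+_ to _+ℕ_; _*_ to _*ℕ_; _∸_ to _∸ℕ_)
open import Data.Nat.Base using (nonTrivial⇒n>1; >-nonZero)
open import Data.Nat.Divisibility
  using (_∣_; divides; ∣m+n∣m⇒∣n; ∣n⇒∣m*n; m∣m*n; n∣m*n; *-cancelʳ-∣; m%n≡0⇒n∣m; ∣⇒≤)
open import Data.Nat.DivMod using (_%_; _/_; m≡m%n+[m/n]*n; [m+kn]%n≡m%n; m%n<n)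
open import Data.Nat.Primality using (prime⇒nonTrivial; prime⇒nonZero)
import Data.Nat.Properties as ℕ
open import Data.Nat.Tactic.RingSolver using (solve-∀)
open import Data.Product using (∃; _,_; proj₁; proj₂)
open import Data.Sum using (inj₁; inj₂)
open import Function using (_∘_)
open import Relation.Nullary using (yes; no)
open import Relation.Binary.PropositionalEquality as ≡ using (_≡_; cong; subst)

module CommutativeRingProperties {c ℓ : Level} (R : CommutativeRing c ℓ) where
  open CommutativeRing R
  open import Algebra.Properties.Ring ring using (-‿distribˡ-*; -‿distribʳ-*; -‿involutive; +-cancelʳ)
  open import Algebra.Solver.Ring.NaturalCoefficients.Default commutativeSemiring
  open import Relation.Binary.Reasoning.Setoid setoid

  -x*-y≈x*y : ∀ x y → - x * - y ≈ x * y
  -x*-y≈x*y x y = begin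
    - x * - y      ≈⟨ -‿distribˡ-* x (- y) ⟨
    - (x * - y)    ≈⟨ -‿cong (-‿distribʳ-* x y) ⟨
    - (- (x * y))  ≈⟨ -‿involutive (x * y) ⟩
    x * y          ∎

  [x-y][a-b]+xb+ya≈xa+yb : ∀ x y a b → (x - y) * (a - b) + (x * b + y * a) ≈ x * a + y * b
  [x-y][a-b]+xb+ya≈xa+yb x y a b = begin
    (x - y) * (a - b) + (x * b + y * a)
      ≈⟨ solve 6 (λ x y a b y' b' → (x :+ y') :* (a :+ b') :+ (x :* b :+ y :* a)
                   := x :* a :+ (x :* (b' :+ b) :+ (y' :+ y) :* a) :+ y' :* b') refl x y a b (- y) (- b) ⟩
    x * a + (x * (- b + b) + (- y + y) * a) + - y * - b
      ≈⟨ +-cong (+-congˡ (+-cong (*-congˡ (-‿inverseˡ b)) (*-congʳ (-‿inverseˡ y)))) (-x*-y≈x*y y b) ⟩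
    x * a + (x * 0# + 0# * a) + y * b
      ≈⟨ +-congʳ (+-congˡ (trans (+-cong (zeroʳ x) (zeroˡ a)) (+-identityˡ 0#))) ⟩
    x * a + 0# + y * b
      ≈⟨ +-congʳ (+-identityʳ (x * a)) ⟩
    x * a + y * b  ∎

  -- With Sₖ = Σₑ yₑzₑᵏ:  (z₀ - z₁)(z₀ - z₃)X = z₀(S₂ - (z₁ + z₃)S₁ + z₁z₃S₀) + y₂(z₀ - z₂)(z₀z₂ - z₁z₃).
  -- The conclusion is (z₀ - z₁)(z₀ - z₃)X = 0 with the negative terms moved across, so that every
  -- step stays within the semiring solver.
  vanishing-power-sums⇒cross : ∀ y₀ y₁ y₂ y₃ z₀ z₁ z₂ z₃ →
    y₀ + y₁ + y₂ + y₃ ≈ 0# →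
    y₀ * z₀ + y₁ * z₁ + y₂ * z₂ + y₃ * z₃ ≈ 0# →
    y₀ * (z₀ * z₀) + y₁ * (z₁ * z₁) + y₂ * (z₂ * z₂) + y₃ * (z₃ * z₃) ≈ 0# →
    z₀ * z₂ ≈ z₁ * z₃ →
    let X = z₀ * y₀ + z₂ * y₂ in
    z₀ * (z₀ * X) + z₁ * (z₃ * X) ≈ z₀ * (z₃ * X) + z₁ * (z₀ * X)
  vanishing-power-sums⇒cross y₀ y₁ y₂ y₃ z₀ z₁ z₂ z₃ S₀≈0 S₁≈0 S₂≈0 z₀z₂≈z₁z₃ =
    +-cancelʳ G _ _ (begin
    z₀ * (z₀ * X) + z₁ * (z₃ * X) + G  ≈⟨ Lhs[0,w] ⟨
    Lhs 0# w                          ≈⟨ Lhs-cong (sym S₁≈0) (sym z₀z₂≈z₁z₃) ⟩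
    Lhs S₁ (z₀ * z₂)                  ≈⟨ expansion ⟩
    Rhs S₀ S₂ (z₀ * z₂)               ≈⟨ Rhs-cong S₀≈0 S₂≈0 z₀z₂≈z₁z₃ ⟩
    Rhs 0# 0# w                       ≈⟨ Rhs[0,0,w] ⟩
    z₀ * (z₃ * X) + z₁ * (z₀ * X) + G  ∎)
    where
    X w G S₀ S₁ S₂ : Carrier
    X = z₀ * y₀ + z₂ * y₂
    w = z₁ * z₃
    G = y₂ * z₂ * w + y₂ * z₀ * w
    S₀ = y₀ + y₁ + y₂ + y₃
    S₁ = y₀ * z₀ + y₁ * z₁ + y₂ * z₂ + y₃ * z₃
    S₂ = y₀ * (z₀ * z₀) + y₁ * (z₁ * z₁) + y₂ * (z₂ * z₂) + y₃ * (z₃ * z₃)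

    Lhs : Carrier → Carrier → Carrier
    Lhs s t = z₀ * (z₀ * X) + z₁ * (z₃ * X) + (z₀ * (z₁ + z₃) * s + y₂ * z₂ * t + y₂ * z₀ * w)
    Rhs : Carrier → Carrier → Carrier → Carrier
    Rhs s s′ t = z₀ * (z₃ * X) + z₁ * (z₀ * X) + (z₀ * s′ + z₀ * w * s + y₂ * z₀ * t + y₂ * z₂ * w)

    Lhs-cong : ∀ {s s′ t t′} → s ≈ s′ → t ≈ t′ → Lhs s t ≈ Lhs s′ t′
    Lhs-cong s≈s′ t≈t′ = +-congˡ (+-congʳ (+-cong (*-congˡ s≈s′) (*-congˡ t≈t′)))
    Rhs-cong : ∀ {s₀ s₂ s₀′ s₂′ t t′} → s₀ ≈ s₀′ → s₂ ≈ s₂′ → t ≈ t′ → Rhs s₀ s₂ t ≈ Rhs s₀′ s₂′ t′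
    Rhs-cong s₀≈s₀′ s₂≈s₂′ t≈t′ =
      +-congˡ (+-congʳ (+-cong (+-cong (*-congˡ s₂≈s₂′) (*-congˡ s₀≈s₀′)) (*-congˡ t≈t′)))

    Lhs[0,w] : Lhs 0# w ≈ z₀ * (z₀ * X) + z₁ * (z₃ * X) + G
    Lhs[0,w] = solve 6 (λ z₀ z₁ z₃ X a b →
        z₀ :* (z₀ :* X) :+ z₁ :* (z₃ :* X) :+ (z₀ :* (z₁ :+ z₃) :* con 0 :+ a :+ b)
      := z₀ :* (z₀ :* X) :+ z₁ :* (z₃ :* X) :+ (a :+ b))
      refl z₀ z₁ z₃ X (y₂ * z₂ * w) (y₂ * z₀ * w)

    Rhs[0,0,w] : Rhs 0# 0# w ≈ z₀ * (z₃ * X) + z₁ * (z₀ * X) + G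
    Rhs[0,0,w] = solve 6 (λ z₀ z₁ z₃ X a b →
        z₀ :* (z₃ :* X) :+ z₁ :* (z₀ :* X) :+ (z₀ :* con 0 :+ z₀ :* (z₁ :* z₃) :* con 0 :+ b :+ a)
      := z₀ :* (z₃ :* X) :+ z₁ :* (z₀ :* X) :+ (a :+ b))
      refl z₀ z₁ z₃ X (y₂ * z₂ * w) (y₂ * z₀ * w)

    expansion : Lhs S₁ (z₀ * z₂) ≈ Rhs S₀ S₂ (z₀ * z₂)
    expansion = solve 8 (λ y₀ y₁ y₂ y₃ z₀ z₁ z₂ z₃ →
      let X = z₀ :* y₀ :+ z₂ :* y₂
          w = z₁ :* z₃
          S₀ = y₀ :+ y₁ :+ y₂ :+ y₃
          S₁ = y₀ :* z₀ :+ y₁ :* z₁ :+ y₂ :* z₂ :+ y₃ :* z₃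
          S₂ = y₀ :* (z₀ :* z₀) :+ y₁ :* (z₁ :* z₁) :+ y₂ :* (z₂ :* z₂) :+ y₃ :* (z₃ :* z₃)
      in  z₀ :* (z₀ :* X) :+ z₁ :* (z₃ :* X)
            :+ (z₀ :* (z₁ :+ z₃) :* S₁ :+ y₂ :* z₂ :* (z₀ :* z₂) :+ y₂ :* z₀ :* w)
       := z₀ :* (z₃ :* X) :+ z₁ :* (z₀ :* X)
            :+ (z₀ :* S₂ :+ z₀ :* w :* S₀ :+ y₂ :* z₀ :* (z₀ :* z₂) :+ y₂ :* z₂ :* w))
      refl y₀ y₁ y₂ y₃ z₀ z₁ z₂ z₃

HasInverses : {c ℓ : Level} → CommutativeRing c ℓ → Set (c ⊔ ℓ)
HasInverses R = ∀ x → ¬ x ≈ 0# → ∃ λ y → x * y ≈ 1#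
  where open CommutativeRing R

module FieldProperties {c ℓ : Level} (R : CommutativeRing c ℓ) (inverse : HasInverses R) where
  open CommutativeRing R
  open CommutativeRingProperties R
  open import Algebra.Properties.Ring ring using (+-cancelˡ; +-cancelʳ; x∙y⁻¹≈ε⇒x≈y; x≈y⇒x∙y⁻¹≈ε; [y-z]x≈yx-zx)
  open import Algebra.Properties.CommutativeSemiring.Exp commutativeSemiring using (^-distrib-*) renaming (_^_ to _^ᶠ_)
  open import Relation.Binary.Reasoning.Setoid setoid

  *-cancelˡ-nonZero : ∀ {x y z} → ¬ x ≈ 0# → x * y ≈ x * z → y ≈ z
  *-cancelˡ-nonZero {x} {y} {z} x≉0 xy≈xz = trans (sym (undo y)) (trans (*-congˡ xy≈xz) (undo z))
    where
    x⁻¹ : Carrier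
    x⁻¹ = proj₁ (inverse x x≉0)
    undo : ∀ w → x⁻¹ * (x * w) ≈ w
    undo w = begin
      x⁻¹ * (x * w)  ≈⟨ *-assoc x⁻¹ x w ⟨
      x⁻¹ * x * w    ≈⟨ *-congʳ (*-comm x⁻¹ x) ⟩
      x * x⁻¹ * w    ≈⟨ *-congʳ (proj₂ (inverse x x≉0)) ⟩
      1# * w         ≈⟨ *-identityˡ w ⟩
      w              ∎

  x≉0⇒x*y≈0⇒y≈0 : ∀ {x y} → ¬ x ≈ 0# → x * y ≈ 0# → y ≈ 0#
  x≉0⇒x*y≈0⇒y≈0 {x} x≉0 xy≈0 = *-cancelˡ-nonZero x≉0 (trans xy≈0 (sym (zeroʳ x)))

  x≉y⇒x-y≉0 : ∀ {x y} → ¬ x ≈ y → ¬ x - y ≈ 0#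
  x≉y⇒x-y≉0 {x} {y} x≉y x-y≈0 = x≉y (x∙y⁻¹≈ε⇒x≈y x y x-y≈0)

  x≉y⇒x*a≈y*a⇒a≈0 : ∀ {x y a} → ¬ x ≈ y → x * a ≈ y * a → a ≈ 0#
  x≉y⇒x*a≈y*a⇒a≈0 {x} {y} {a} x≉y xa≈ya =
    x≉0⇒x*y≈0⇒y≈0 (x≉y⇒x-y≉0 x≉y) (trans ([y-z]x≈yx-zx a x y) (x≈y⇒x∙y⁻¹≈ε xa≈ya))

  x≉y⇒xa+yb≈xb+ya⇒a≈b : ∀ {x y a b} → ¬ x ≈ y → x * a + y * b ≈ x * b + y * a → a ≈ b
  x≉y⇒xa+yb≈xb+ya⇒a≈b {x} {y} {a} {b} x≉y eq =
    x∙y⁻¹≈ε⇒x≈y a b (x≉0⇒x*y≈0⇒y≈0 (x≉y⇒x-y≉0 x≉y) [x-y][a-b]≈0)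
    where
    [x-y][a-b]≈0 : (x - y) * (a - b) ≈ 0#
    [x-y][a-b]≈0 = +-cancelʳ (x * b + y * a) _ _
      (trans ([x-y][a-b]+xb+ya≈xa+yb x y a b) (trans eq (sym (+-identityˡ _))))

  vanishing-power-sums : ∀ y₀ y₁ y₂ y₃ z₀ z₁ z₂ z₃ →
    y₀ + y₁ + y₂ + y₃ ≈ 0# →
    y₀ * z₀ + y₁ * z₁ + y₂ * z₂ + y₃ * z₃ ≈ 0# →
    y₀ * (z₀ * z₀) + y₁ * (z₁ * z₁) + y₂ * (z₂ * z₂) + y₃ * (z₃ * z₃) ≈ 0# →
    z₀ * z₂ ≈ z₁ * z₃ → ¬ z₀ ≈ z₁ → ¬ z₀ ≈ z₃ →
    z₀ * y₀ + z₂ * y₂ ≈ 0#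
  vanishing-power-sums y₀ y₁ y₂ y₃ z₀ z₁ z₂ z₃ S₀≈0 S₁≈0 S₂≈0 z₀z₂≈z₁z₃ z₀≉z₁ z₀≉z₃ =
    x≉y⇒x*a≈y*a⇒a≈0 z₀≉z₃ (x≉y⇒xa+yb≈xb+ya⇒a≈b z₀≉z₁
      (vanishing-power-sums⇒cross y₀ y₁ y₂ y₃ z₀ z₁ z₂ z₃ S₀≈0 S₁≈0 S₂≈0 z₀z₂≈z₁z₃))

  a+aⁿ≈0⇒aw+[aw]ⁿ≈0⇒wⁿ≈w : ∀ {a w} n → ¬ a ^ᶠ n ≈ 0# →
    a + a ^ᶠ n ≈ 0# → a * w + (a * w) ^ᶠ n ≈ 0# → w ^ᶠ n ≈ w
  a+aⁿ≈0⇒aw+[aw]ⁿ≈0⇒wⁿ≈w {a} {w} n aⁿ≉0 a+aⁿ≈0 aw+[aw]ⁿ≈0 =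
    *-cancelˡ-nonZero aⁿ≉0 (+-cancelˡ (a * w) _ _ (begin
      a * w + a ^ᶠ n * w ^ᶠ n  ≈⟨ +-congˡ (^-distrib-* a w n) ⟨
      a * w + (a * w) ^ᶠ n     ≈⟨ aw+[aw]ⁿ≈0 ⟩
      0#                       ≈⟨ zeroˡ w ⟨
      0# * w                   ≈⟨ *-congʳ a+aⁿ≈0 ⟨
      (a + a ^ᶠ n) * w         ≈⟨ distribʳ w a (a ^ᶠ n) ⟩
      a * w + a ^ᶠ n * w       ∎))

module PrimitiveElement {c ℓ : Level} {N : ℕ} (F : FiniteField c ℓ N) {α : FiniteField.Carrier F}
  (α-primitive : IsPrimitive F α) .{{_ : NonZero (N ∸ℕ 1)}} where
  open FiniteField F
  open FieldProperties commRing inverse using (*-cancelˡ-nonZero; x≉0⇒x*y≈0⇒y≈0)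
  open import Algebra.Properties.Semiring.Exp semiring using (^-homo-*; ^-assocʳ; ^-congˡ)
  open import Relation.Binary.Reasoning.Setoid setoid

  α^[[N∸1]*k]≈1 : ∀ k → α ^ᶠ ((N ∸ℕ 1) *ℕ k) ≈ 1#
  α^[[N∸1]*k]≈1 k = begin
    α ^ᶠ ((N ∸ℕ 1) *ℕ k)   ≈⟨ ^-assocʳ α (N ∸ℕ 1) k ⟨
    (α ^ᶠ (N ∸ℕ 1)) ^ᶠ k   ≈⟨ ^-congˡ k (proj₁ α-primitive) ⟩
    1# ^ᶠ k                ≈⟨ 1^k≈1 k ⟩
    1#                     ∎
    where
    1^k≈1 : ∀ k → 1# ^ᶠ k ≈ 1#
    1^k≈1 zero    = refl
    1^k≈1 (suc k) = trans (*-identityˡ _) (1^k≈1 k)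

  α^n≉0 : ∀ n → ¬ α ^ᶠ n ≈ 0#
  α^n≉0 zero    1≈0 = 0≉1 (sym 1≈0)
  α^n≉0 (suc n) α^[1+n]≈0 = α^n≉0 n (x≉0⇒x*y≈0⇒y≈0 α≉0 α^[1+n]≈0)
    where
    α≉0 : ¬ α ≈ 0#
    α≉0 α≈0 = 0≉1 (begin
      0#                         ≈⟨ zeroˡ _ ⟨
      0# * α ^ᶠ pred (N ∸ℕ 1)    ≈⟨ *-congʳ α≈0 ⟨
      α ^ᶠ suc (pred (N ∸ℕ 1))   ≡⟨ cong (α ^ᶠ_) (ℕ.suc-pred (N ∸ℕ 1)) ⟩
      α ^ᶠ (N ∸ℕ 1)              ≈⟨ proj₁ α-primitive ⟩
      1#                         ∎)

  α^k≈1⇒[N∸1]∣k : ∀ {k} → α ^ᶠ k ≈ 1# → N ∸ℕ 1 ∣ k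
  α^k≈1⇒[N∸1]∣k {k} α^k≈1 with k % (N ∸ℕ 1) ℕ.≟ 0
  ... | yes r≡0 = m%n≡0⇒n∣m k (N ∸ℕ 1) r≡0
  ... | no  r≢0 = ⊥-elim (proj₂ α-primitive r (ℕ.n≢0⇒n>0 r≢0) (m%n<n k (N ∸ℕ 1)) (begin
      α ^ᶠ r                                      ≈⟨ *-identityʳ _ ⟨
      α ^ᶠ r * 1#                                 ≈⟨ *-congˡ (α^[[N∸1]*k]≈1 (k / (N ∸ℕ 1))) ⟨
      α ^ᶠ r * α ^ᶠ ((N ∸ℕ 1) *ℕ (k / (N ∸ℕ 1)))  ≈⟨ ^-homo-* α r _ ⟨
      α ^ᶠ (r +ℕ (N ∸ℕ 1) *ℕ (k / (N ∸ℕ 1)))      ≡⟨ cong (α ^ᶠ_) k≡r+[N∸1]*[k/[N∸1]] ⟨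
      α ^ᶠ k                                      ≈⟨ α^k≈1 ⟩
      1#                                          ∎))
    where
    r : ℕ
    r = k % (N ∸ℕ 1)
    k≡r+[N∸1]*[k/[N∸1]] : k ≡ r +ℕ (N ∸ℕ 1) *ℕ (k / (N ∸ℕ 1))
    k≡r+[N∸1]*[k/[N∸1]] =
      ≡.trans (m≡m%n+[m/n]*n k (N ∸ℕ 1)) (cong (r +ℕ_) (ℕ.*-comm (k / (N ∸ℕ 1)) (N ∸ℕ 1)))

  α^[a+k]≈α^a⇒[N∸1]∣k : ∀ a {k} → α ^ᶠ (a +ℕ k) ≈ α ^ᶠ a → N ∸ℕ 1 ∣ k
  α^[a+k]≈α^a⇒[N∸1]∣k a {k} α^[a+k]≈α^a = α^k≈1⇒[N∸1]∣k (*-cancelˡ-nonZero (α^n≉0 a) (begin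
    α ^ᶠ a * α ^ᶠ k   ≈⟨ ^-homo-* α a k ⟨
    α ^ᶠ (a +ℕ k)     ≈⟨ α^[a+k]≈α^a ⟩
    α ^ᶠ a            ≈⟨ *-identityʳ _ ⟨
    α ^ᶠ a * 1#       ∎))

  [N∸1]∣k⇒α^[a+k]≈α^a : ∀ a {k} → N ∸ℕ 1 ∣ k → α ^ᶠ (a +ℕ k) ≈ α ^ᶠ a
  [N∸1]∣k⇒α^[a+k]≈α^a a {k} (divides t k≡t*[N∸1]) = begin
    α ^ᶠ (a +ℕ k)                  ≈⟨ ^-homo-* α a k ⟩
    α ^ᶠ a * α ^ᶠ k                ≡⟨ cong (λ e → α ^ᶠ a * α ^ᶠ e) k≡[N∸1]*t ⟩
    α ^ᶠ a * α ^ᶠ ((N ∸ℕ 1) *ℕ t)  ≈⟨ *-congˡ (α^[[N∸1]*k]≈1 t) ⟩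
    α ^ᶠ a * 1#                    ≈⟨ *-identityʳ _ ⟩
    α ^ᶠ a                         ∎
    where
    k≡[N∸1]*t : k ≡ (N ∸ℕ 1) *ℕ t
    k≡[N∸1]*t = ≡.trans k≡t*[N∸1] (ℕ.*-comm t (N ∸ℕ 1))

  [α^a]^[1+k]≈α^[a+a*k] : ∀ a k → (α ^ᶠ a) ^ᶠ suc k ≈ α ^ᶠ (a +ℕ a *ℕ k)
  [α^a]^[1+k]≈α^[a+a*k] a k = trans (^-assocʳ α a (suc k)) (reflexive (cong (α ^ᶠ_) (ℕ.*-suc a k)))

  [α^a]^[1+k]≈α^a⇒[N∸1]∣a*k : ∀ a k → (α ^ᶠ a) ^ᶠ suc k ≈ α ^ᶠ a → N ∸ℕ 1 ∣ a *ℕ k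
  [α^a]^[1+k]≈α^a⇒[N∸1]∣a*k a k fixed = α^[a+k]≈α^a⇒[N∸1]∣k a (trans (sym ([α^a]^[1+k]≈α^[a+a*k] a k)) fixed)

  [N∸1]∣a*k⇒[α^a]^[1+k]≈α^a : ∀ a k → N ∸ℕ 1 ∣ a *ℕ k → (α ^ᶠ a) ^ᶠ suc k ≈ α ^ᶠ a
  [N∸1]∣a*k⇒[α^a]^[1+k]≈α^a a k ∣a*k = trans ([α^a]^[1+k]≈α^[a+a*k] a k) ([N∸1]∣k⇒α^[a+k]≈α^a a ∣a*k)

module TraceProperties {c ℓ : Level} (q : ℕ) (F : FiniteField c ℓ (q ^ 4)) where
  open FiniteField F
  open FieldProperties commRing inverse using (vanishing-power-sums)
  open import Algebra.Properties.CommutativeSemiring.Exp commutativeSemiring using (^-distrib-*; ^-assocʳ; ^-congˡ)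
  open import Algebra.Solver.Ring.NaturalCoefficients.Default commutativeSemiring
  open import Relation.Binary.Reasoning.Setoid setoid

  Tr₂ : Carrier → Carrier
  Tr₂ a = a + a ^ᶠ (q ^ 2)

  Tr₂-cong : ∀ {a b} → a ≈ b → Tr₂ a ≈ Tr₂ b
  Tr₂-cong a≈b = +-cong a≈b (^-congˡ (q ^ 2) a≈b)

  Tr-cong : ∀ {a b} → a ≈ b → Tr q F a ≈ Tr q F b
  Tr-cong a≈b = +-cong (+-cong (+-cong a≈b (^-congˡ q a≈b)) (^-congˡ (q ^ 2) a≈b)) (^-congˡ (q ^ 3) a≈b)

  Tr-* : ∀ u v → Tr q F (u * v) ≈
    u * v + u ^ᶠ q * v ^ᶠ q + u ^ᶠ (q ^ 2) * v ^ᶠ (q ^ 2) + u ^ᶠ (q ^ 3) * v ^ᶠ (q ^ 3)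
  Tr-* u v = +-cong (+-cong (+-congˡ (^-distrib-* u v q)) (^-distrib-* u v (q ^ 2))) (^-distrib-* u v (q ^ 3))

  b^q≈b⇒b^[q^e]≈b : ∀ {b} → b ^ᶠ q ≈ b → ∀ e → b ^ᶠ (q ^ e) ≈ b
  b^q≈b⇒b^[q^e]≈b {b} b^q≈b zero    = *-identityʳ b
  b^q≈b⇒b^[q^e]≈b {b} b^q≈b (suc e) = begin
    b ^ᶠ (q ^ suc e)      ≈⟨ ^-assocʳ b q (q ^ e) ⟨
    (b ^ᶠ q) ^ᶠ (q ^ e)   ≈⟨ ^-congˡ (q ^ e) b^q≈b ⟩
    b ^ᶠ (q ^ e)          ≈⟨ b^q≈b⇒b^[q^e]≈b b^q≈b e ⟩
    b                     ∎

  Tr-*-fixed : ∀ a {b} → b ^ᶠ q ≈ b → Tr q F (a * b) ≈ Tr q F a * b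
  Tr-*-fixed a {b} b^q≈b = begin
    Tr q F (a * b)
      ≈⟨ Tr-* a b ⟩
    a * b + a ^ᶠ q * b ^ᶠ q + a ^ᶠ (q ^ 2) * b ^ᶠ (q ^ 2) + a ^ᶠ (q ^ 3) * b ^ᶠ (q ^ 3)
      ≈⟨ +-cong (+-cong (+-congˡ (*-congˡ b^q≈b)) (*-congˡ (fixed 2))) (*-congˡ (fixed 3)) ⟩
    a * b + a ^ᶠ q * b + a ^ᶠ (q ^ 2) * b + a ^ᶠ (q ^ 3) * b
      ≈⟨ solve 5 (λ a₀ a₁ a₂ a₃ b → a₀ :* b :+ a₁ :* b :+ a₂ :* b :+ a₃ :* b := (a₀ :+ a₁ :+ a₂ :+ a₃) :* b)
           refl a (a ^ᶠ q) (a ^ᶠ (q ^ 2)) (a ^ᶠ (q ^ 3)) b ⟩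
    Tr q F a * b  ∎
    where
    fixed : ∀ e → b ^ᶠ (q ^ e) ≈ b
    fixed = b^q≈b⇒b^[q^e]≈b b^q≈b

  [v*v^q²]^q≈v^q*v^q³ : ∀ v → (v * v ^ᶠ (q ^ 2)) ^ᶠ q ≈ v ^ᶠ q * v ^ᶠ (q ^ 3)
  [v*v^q²]^q≈v^q*v^q³ v = begin
    (v * v ^ᶠ (q ^ 2)) ^ᶠ q          ≈⟨ ^-distrib-* v (v ^ᶠ (q ^ 2)) q ⟩
    v ^ᶠ q * (v ^ᶠ (q ^ 2)) ^ᶠ q     ≈⟨ *-congˡ (^-assocʳ v (q ^ 2) q) ⟩
    v ^ᶠ q * v ^ᶠ (q ^ 2 *ℕ q)      ≡⟨ cong (λ e → v ^ᶠ q * v ^ᶠ e) (ℕ.*-comm (q ^ 2) q) ⟩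
    v ^ᶠ q * v ^ᶠ (q ^ 3)           ∎

  Tr[u]≈Tr[uv]≈Tr[uv²]≈0⇒Tr₂[uv]≈0 : ∀ u v →
    Tr q F u ≈ 0# → Tr q F (u * v) ≈ 0# → Tr q F (u * (v * v)) ≈ 0# →
    v * v ^ᶠ (q ^ 2) ≈ v ^ᶠ q * v ^ᶠ (q ^ 3) → ¬ v ^ᶠ q ≈ v → ¬ v ^ᶠ (q ^ 3) ≈ v →
    Tr₂ (u * v) ≈ 0#
  Tr[u]≈Tr[uv]≈Tr[uv²]≈0⇒Tr₂[uv]≈0 u v Tr[u]≈0 Tr[uv]≈0 Tr[uv²]≈0 norm v^q≉v v^q³≉v = begin
    u * v + (u * v) ^ᶠ (q ^ 2)               ≈⟨ +-cong (*-comm u v) (trans (^-distrib-* u v (q ^ 2)) (*-comm _ _)) ⟩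
    v * u + v ^ᶠ (q ^ 2) * u ^ᶠ (q ^ 2)      ≈⟨ vanishing-power-sums
                                                  u (u ^ᶠ q) (u ^ᶠ (q ^ 2)) (u ^ᶠ (q ^ 3))
                                                  v (v ^ᶠ q) (v ^ᶠ (q ^ 2)) (v ^ᶠ (q ^ 3))
                                                  Tr[u]≈0 (trans (sym (Tr-* u v)) Tr[uv]≈0) power-sum₂
                                                  norm (v^q≉v ∘ sym) (v^q³≉v ∘ sym) ⟩
    0#                                       ∎
    where
    power-sum₂ : u * (v * v) + u ^ᶠ q * (v ^ᶠ q * v ^ᶠ q)
               + u ^ᶠ (q ^ 2) * (v ^ᶠ (q ^ 2) * v ^ᶠ (q ^ 2)) + u ^ᶠ (q ^ 3) * (v ^ᶠ (q ^ 3) * v ^ᶠ (q ^ 3)) ≈ 0#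
    power-sum₂ = trans (sym (trans (Tr-* u (v * v))
      (+-cong (+-cong (+-congˡ (*-congˡ (^-distrib-* v v q))) (*-congˡ (^-distrib-* v v (q ^ 2))))
              (*-congˡ (^-distrib-* v v (q ^ 3)))))) Tr[uv²]≈0

twice-+-∣ : ∀ q j {d} → m₂ q ∣ 2 *ℕ d → twice q (j +ℕ d) ≡ twice q j
twice-+-∣ q j {d} (divides t 2d≡t*m) =
  ≡.trans (cong (_% m₂ q) 2[j+d]≡2j+t*m) ([m+kn]%n≡m%n (2 *ℕ j) t (m₂ q))
  where
  2[j+d]≡2j+t*m : 2 *ℕ (j +ℕ d) ≡ 2 *ℕ j +ℕ t *ℕ m₂ q
  2[j+d]≡2j+t*m = ≡.trans (ℕ.*-distribˡ-+ 2 j d) (cong (2 *ℕ j +ℕ_) 2d≡t*m)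

-- q = p + 1, m = q² + 1 and Q = q² - 1, so that q⁴ - 1 = mQ. The ring solver does not read _^_,
-- hence the powers written out in the expanded forms.
module Arithmetic (p : ℕ) where
  open import Data.Nat using (_+_; _*_; _∸_)

  q m Q : ℕ
  q = suc p
  m = m₂ q
  Q = (q + 1) * p

  q^2≡1+Q : q ^ 2 ≡ suc Q
  q^2≡1+Q = expanded p
    where
    expanded : ∀ p → suc p * (suc p * 1) ≡ suc ((suc p + 1) * p)
    expanded = solve-∀

  q^4≡1+m*Q : q ^ 4 ≡ suc (m * Q)
  q^4≡1+m*Q = expanded p
    where
    expanded : ∀ p → suc p * (suc p * (suc p * (suc p * 1))) ≡ suc (suc (suc p * (suc p * 1)) * ((suc p + 1) * p))
    expanded = solve-∀

  q^4∸1≡m*Q : q ^ 4 ∸ 1 ≡ m * Q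
  q^4∸1≡m*Q = cong (_∸ 1) q^4≡1+m*Q

  m*d≡p*[[q+1]*d]+2*d : ∀ d → m * d ≡ p * ((q + 1) * d) + 2 * d
  m*d≡p*[[q+1]*d]+2*d = expanded p
    where
    expanded : ∀ p d → suc (suc p * (suc p * 1)) * d ≡ p * ((suc p + 1) * d) + 2 * d
    expanded = solve-∀

  [q+1]k+[q+1]k*q^2≡m*[q+1]*k : ∀ k → (q + 1) * k + (q + 1) * k * q ^ 2 ≡ m * (q + 1) * k
  [q+1]k+[q+1]k*q^2≡m*[q+1]*k = expanded p
    where
    expanded : ∀ p k → (suc p + 1) * k + (suc p + 1) * k * (suc p * (suc p * 1)) ≡ suc (suc p * (suc p * 1)) * (suc p + 1) * k
    expanded = solve-∀

module PrimitiveTrace {c ℓ : Level} (p : ℕ) .{{_ : NonZero p}} (F : FiniteField c ℓ (suc p ^ 4))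
  {α : FiniteField.Carrier F} (α-primitive : IsPrimitive F α) where
  open Arithmetic p
  open FiniteField F
  open FieldProperties commRing inverse using (a+aⁿ≈0⇒aw+[aw]ⁿ≈0⇒wⁿ≈w)
  open TraceProperties q F
  open import Algebra.Properties.Semiring.Exp semiring using (^-homo-*; ^-assocʳ; ^-congˡ; ^-congʳ)
  open import Relation.Binary.Reasoning.Setoid setoid

  instance
    Q≢0 : NonZero Q
    Q≢0 = ℕ.m*n≢0 (q +ℕ 1) p

    q^4∸1≢0 : NonZero (q ^ 4 ∸ℕ 1)
    q^4∸1≢0 = subst NonZero (≡.sym q^4∸1≡m*Q) (ℕ.m*n≢0 m Q)

  open PrimitiveElement F α-primitive

  [q^4∸1]∣a⇒m*Q∣a : ∀ {a} → q ^ 4 ∸ℕ 1 ∣ a → m *ℕ Q ∣ a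
  [q^4∸1]∣a⇒m*Q∣a {a} = subst (_∣ a) q^4∸1≡m*Q

  m*Q∣a⇒[q^4∸1]∣a : ∀ {a} → m *ℕ Q ∣ a → q ^ 4 ∸ℕ 1 ∣ a
  m*Q∣a⇒[q^4∸1]∣a {a} = subst (_∣ a) (≡.sym q^4∸1≡m*Q)

  [α^a]^[q^4]≈α^a : ∀ a → (α ^ᶠ a) ^ᶠ (q ^ 4) ≈ α ^ᶠ a
  [α^a]^[q^4]≈α^a a = trans (^-congʳ (α ^ᶠ a) q^4≡1+m*Q)
    ([N∸1]∣a*k⇒[α^a]^[1+k]≈α^a a (m *ℕ Q) (m*Q∣a⇒[q^4∸1]∣a (n∣m*n a)))

  α^[n*t]^q≈α^[n*t] : ∀ t → (α ^ᶠ (nD q F *ℕ t)) ^ᶠ q ≈ α ^ᶠ (nD q F *ℕ t)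
  α^[n*t]^q≈α^[n*t] t = [N∸1]∣a*k⇒[α^a]^[1+k]≈α^a (nD q F *ℕ t) p
    (m*Q∣a⇒[q^4∸1]∣a (divides t (rearranged m q t p)))
    where
    rearranged : ∀ m q t p → m *ℕ (q +ℕ 1) *ℕ t *ℕ p ≡ t *ℕ (m *ℕ ((q +ℕ 1) *ℕ p))
    rearranged = solve-∀

  β : ℕ → Carrier
  β k = α ^ᶠ ((q +ℕ 1) *ℕ k)

  β*β^q²≈β^q*β^q³ : ∀ k → β k * β k ^ᶠ (q ^ 2) ≈ β k ^ᶠ q * β k ^ᶠ (q ^ 3)
  β*β^q²≈β^q*β^q³ k = begin
    β k * β k ^ᶠ (q ^ 2)             ≈⟨ β*β^q²≈α^[n*k] ⟩
    α ^ᶠ (nD q F *ℕ k)               ≈⟨ α^[n*t]^q≈α^[n*t] k ⟨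
    (α ^ᶠ (nD q F *ℕ k)) ^ᶠ q        ≈⟨ ^-congˡ q β*β^q²≈α^[n*k] ⟨
    (β k * β k ^ᶠ (q ^ 2)) ^ᶠ q      ≈⟨ [v*v^q²]^q≈v^q*v^q³ (β k) ⟩
    β k ^ᶠ q * β k ^ᶠ (q ^ 3)        ∎
    where
    a : ℕ
    a = (q +ℕ 1) *ℕ k
    β*β^q²≈α^[n*k] : β k * β k ^ᶠ (q ^ 2) ≈ α ^ᶠ (nD q F *ℕ k)
    β*β^q²≈α^[n*k] = begin
      α ^ᶠ a * (α ^ᶠ a) ^ᶠ (q ^ 2)   ≈⟨ *-congˡ (^-assocʳ α a (q ^ 2)) ⟩
      α ^ᶠ a * α ^ᶠ (a *ℕ q ^ 2)     ≈⟨ ^-homo-* α a (a *ℕ q ^ 2) ⟨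
      α ^ᶠ (a +ℕ a *ℕ q ^ 2)         ≡⟨ cong (α ^ᶠ_) ([q+1]k+[q+1]k*q^2≡m*[q+1]*k k) ⟩
      α ^ᶠ (nD q F *ℕ k)             ∎

  module _ {k : ℕ} (0≢k : 0 ≢ k) (k<m : k < m) where

    β^q≉β : ¬ β k ^ᶠ q ≈ β k
    β^q≉β β^q≈β = ℕ.<⇒≱ k<m (∣⇒≤ {{>-nonZero (ℕ.n≢0⇒n>0 (0≢k ∘ ≡.sym))}} m∣k)
      where
      m*Q∣k*Q : m *ℕ Q ∣ k *ℕ Q
      m*Q∣k*Q = subst (m *ℕ Q ∣_) (rearranged q k p)
        ([q^4∸1]∣a⇒m*Q∣a ([α^a]^[1+k]≈α^a⇒[N∸1]∣a*k ((q +ℕ 1) *ℕ k) p β^q≈β))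
        where
        rearranged : ∀ q k p → (q +ℕ 1) *ℕ k *ℕ p ≡ k *ℕ ((q +ℕ 1) *ℕ p)
        rearranged = solve-∀
      m∣k : m ∣ k
      m∣k = *-cancelʳ-∣ Q m*Q∣k*Q

    β^q³≉β : ¬ β k ^ᶠ (q ^ 3) ≈ β k
    β^q³≉β β^q³≈β = β^q≉β (begin
      β k ^ᶠ q                  ≈⟨ ^-congˡ q β^q³≈β ⟨
      (β k ^ᶠ (q ^ 3)) ^ᶠ q     ≈⟨ ^-assocʳ (β k) (q ^ 3) q ⟩
      β k ^ᶠ (q ^ 3 *ℕ q)       ≡⟨ cong (β k ^ᶠ_) (ℕ.*-comm (q ^ 3) q) ⟩
      β k ^ᶠ (q ^ 4)            ≈⟨ [α^a]^[q^4]≈α^a ((q +ℕ 1) *ℕ k) ⟩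
      β k                       ∎)

  -- twice q k differs from 2k by a multiple t of m, and Tr is linear over the Frobenius-fixed α^{nt}
  InC[x,twice[k]]⇒Tr[α^[x+[q+1]*2k]]≈0 : ∀ x k → InC q F α x (twice q k) →
    Tr q F (α ^ᶠ (x +ℕ (q +ℕ 1) *ℕ (2 *ℕ k))) ≈ 0#
  InC[x,twice[k]]⇒Tr[α^[x+[q+1]*2k]]≈0 x k (_ , Tr≈0) = begin
    Tr q F (α ^ᶠ (x +ℕ (q +ℕ 1) *ℕ (2 *ℕ k)))                  ≡⟨ cong (λ e → Tr q F (α ^ᶠ e)) exponent ⟩
    Tr q F (α ^ᶠ (e +ℕ nD q F *ℕ t))                          ≈⟨ Tr-cong (^-homo-* α e (nD q F *ℕ t)) ⟩
    Tr q F (α ^ᶠ e * α ^ᶠ (nD q F *ℕ t))                      ≈⟨ Tr-*-fixed (α ^ᶠ e) (α^[n*t]^q≈α^[n*t] t) ⟩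
    Tr q F (α ^ᶠ e) * α ^ᶠ (nD q F *ℕ t)                      ≈⟨ *-congʳ Tr≈0 ⟩
    0# * α ^ᶠ (nD q F *ℕ t)                                   ≈⟨ zeroˡ _ ⟩
    0#                                                        ∎
    where
    s t e : ℕ
    s = twice q k
    t = (2 *ℕ k) / m
    e = x +ℕ (q +ℕ 1) *ℕ s
    exponent : x +ℕ (q +ℕ 1) *ℕ (2 *ℕ k) ≡ e +ℕ nD q F *ℕ t
    exponent = ≡.trans (cong (λ e → x +ℕ (q +ℕ 1) *ℕ e) (m≡m%n+[m/n]*n (2 *ℕ k) m)) (rearranged x q s t m)
      where
      rearranged : ∀ x q s t m → x +ℕ (q +ℕ 1) *ℕ (s +ℕ t *ℕ m) ≡ x +ℕ (q +ℕ 1) *ℕ s +ℕ m *ℕ (q +ℕ 1) *ℕ t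
      rearranged = solve-∀

  InC⇒Tr₂[α^x*β]≈0 : ∀ x {k} → 0 ≢ k → k < m →
    InC q F α x 0 → InC q F α x k → InC q F α x (twice q k) → Tr₂ (α ^ᶠ x * β k) ≈ 0#
  InC⇒Tr₂[α^x*β]≈0 x {k} 0≢k k<m (_ , Tr₀≈0) (_ , Trₖ≈0) C₂ₖ =
    Tr[u]≈Tr[uv]≈Tr[uv²]≈0⇒Tr₂[uv]≈0 (α ^ᶠ x) (β k)
      (trans (Tr-cong (reflexive (cong (α ^ᶠ_) x≡x+[q+1]*0))) Tr₀≈0)
      (trans (Tr-cong (sym (^-homo-* α x a))) Trₖ≈0)
      (trans (Tr-cong α^x*β²≈α^[x+[q+1]*2k]) (InC[x,twice[k]]⇒Tr[α^[x+[q+1]*2k]]≈0 x k C₂ₖ))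
      (β*β^q²≈β^q*β^q³ k) (β^q≉β 0≢k k<m) (β^q³≉β 0≢k k<m)
    where
    a : ℕ
    a = (q +ℕ 1) *ℕ k
    x≡x+[q+1]*0 : x ≡ x +ℕ (q +ℕ 1) *ℕ 0
    x≡x+[q+1]*0 = ≡.sym (≡.trans (cong (x +ℕ_) (ℕ.*-zeroʳ (q +ℕ 1))) (ℕ.+-identityʳ x))
    α^x*β²≈α^[x+[q+1]*2k] : α ^ᶠ x * (β k * β k) ≈ α ^ᶠ (x +ℕ (q +ℕ 1) *ℕ (2 *ℕ k))
    α^x*β²≈α^[x+[q+1]*2k] = begin
      α ^ᶠ x * (β k * β k)               ≈⟨ *-congˡ (^-homo-* α a a) ⟨
      α ^ᶠ x * α ^ᶠ (a +ℕ a)             ≈⟨ ^-homo-* α x (a +ℕ a) ⟨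
      α ^ᶠ (x +ℕ (a +ℕ a))               ≡⟨ cong (α ^ᶠ_) (rearranged x q k) ⟩
      α ^ᶠ (x +ℕ (q +ℕ 1) *ℕ (2 *ℕ k))   ∎
      where
      rearranged : ∀ x q k → x +ℕ ((q +ℕ 1) *ℕ k +ℕ (q +ℕ 1) *ℕ k) ≡ x +ℕ (q +ℕ 1) *ℕ (2 *ℕ k)
      rearranged = solve-∀

  β^q²≈β⇒m∣2d : ∀ d → β d ^ᶠ (q ^ 2) ≈ β d → m ∣ 2 *ℕ d
  β^q²≈β⇒m∣2d d β^q²≈β =
    ∣m+n∣m⇒∣n (subst (m ∣_) (m*d≡p*[[q+1]*d]+2*d d) (m∣m*n d)) (∣n⇒∣m*n p m∣[q+1]d)
    where
    m∣[q+1]d : m ∣ (q +ℕ 1) *ℕ d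
    m∣[q+1]d = *-cancelʳ-∣ Q ([q^4∸1]∣a⇒m*Q∣a ([α^a]^[1+k]≈α^a⇒[N∸1]∣a*k ((q +ℕ 1) *ℕ d) Q
      (trans (sym (^-congʳ (β d) q^2≡1+Q)) β^q²≈β)))

  Tr₂[α^x*β]≈0⇒twice[j+d]≡twice[j] : ∀ x j d →
    Tr₂ (α ^ᶠ x * β (j +ℕ d)) ≈ 0# → Tr₂ (α ^ᶠ x * β j) ≈ 0# → twice q (j +ℕ d) ≡ twice q j
  Tr₂[α^x*β]≈0⇒twice[j+d]≡twice[j] x j d Eⱼ₊d Eⱼ = twice-+-∣ q j (β^q²≈β⇒m∣2d d
    (a+aⁿ≈0⇒aw+[aw]ⁿ≈0⇒wⁿ≈w (q ^ 2) [α^x*β]^q²≉0 Eⱼ (trans (Tr₂-cong α^x*β*β≈α^x*β[j+d]) Eⱼ₊d)))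
    where
    e : ℕ
    e = x +ℕ (q +ℕ 1) *ℕ j
    [α^x*β]^q²≉0 : ¬ (α ^ᶠ x * β j) ^ᶠ (q ^ 2) ≈ 0#
    [α^x*β]^q²≉0 [α^x*β]^q²≈0 = α^n≉0 (e *ℕ q ^ 2) (begin
      α ^ᶠ (e *ℕ q ^ 2)           ≈⟨ ^-assocʳ α e (q ^ 2) ⟨
      (α ^ᶠ e) ^ᶠ (q ^ 2)         ≈⟨ ^-congˡ (q ^ 2) (^-homo-* α x ((q +ℕ 1) *ℕ j)) ⟩
      (α ^ᶠ x * β j) ^ᶠ (q ^ 2)   ≈⟨ [α^x*β]^q²≈0 ⟩
      0#                          ∎)
    α^x*β*β≈α^x*β[j+d] : α ^ᶠ x * β j * β d ≈ α ^ᶠ x * β (j +ℕ d)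
    α^x*β*β≈α^x*β[j+d] = begin
      α ^ᶠ x * β j * β d
        ≈⟨ *-assoc (α ^ᶠ x) (β j) (β d) ⟩
      α ^ᶠ x * (β j * β d)
        ≈⟨ *-congˡ (^-homo-* α ((q +ℕ 1) *ℕ j) ((q +ℕ 1) *ℕ d)) ⟨
      α ^ᶠ x * α ^ᶠ ((q +ℕ 1) *ℕ j +ℕ (q +ℕ 1) *ℕ d)
        ≡⟨ cong (λ e → α ^ᶠ x * α ^ᶠ e) (ℕ.*-distribˡ-+ (q +ℕ 1) j d) ⟨
      α ^ᶠ x * β (j +ℕ d)  ∎

  Tr₂[α^x*β]≈0⇒twice≡ : ∀ x i j →
    Tr₂ (α ^ᶠ x * β i) ≈ 0# → Tr₂ (α ^ᶠ x * β j) ≈ 0# → twice q i ≡ twice q j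
  Tr₂[α^x*β]≈0⇒twice≡ x i j Eᵢ Eⱼ with ℕ.≤-total j i
  ... | inj₁ j≤i with ℕ.m≤n⇒∃[o]m+o≡n j≤i
  ...   | d , ≡.refl = Tr₂[α^x*β]≈0⇒twice[j+d]≡twice[j] x j d Eᵢ Eⱼ
  Tr₂[α^x*β]≈0⇒twice≡ x i j Eᵢ Eⱼ | inj₂ i≤j with ℕ.m≤n⇒∃[o]m+o≡n i≤j
  ...   | d , ≡.refl = ≡.sym (Tr₂[α^x*β]≈0⇒twice[j+d]≡twice[j] x i d Eⱼ Eᵢ)

-- Only q ≥ 2 is used below; the argument does not need q to be odd.
2≤oddPrimePower : ∀ {q} → IsOddPrimePower q → 2 ≤ q
2≤oddPrimePower (p , suc k , p-prime , _ , _ , ≡.refl) =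
  ℕ.≤-trans (nonTrivial⇒n>1 p {{prime⇒nonTrivial p-prime}})
            (ℕ.m≤m*n p (p ^ k) {{ℕ.m^n≢0 p k {{prime⇒nonZero p-prime}}}})

mainTheorem16 : {c ℓ : Level} (q : ℕ) → IsOddPrimePower q →
    (F : FiniteField c ℓ (q ^ 4)) → (α : FiniteField.Carrier F) → IsPrimitive F α →
    ¬ (Σ ℕ λ x → Σ ℕ λ i → Σ ℕ λ j →
        InD q F α x × i < m₂ q × j < m₂ q ×
        (0 ≢ i) × (0 ≢ j) × (0 ≢ twice q i) × (0 ≢ twice q j) ×
        (i ≢ j) × (i ≢ twice q i) × (i ≢ twice q j) ×
        (j ≢ twice q i) × (j ≢ twice q j) × (twice q i ≢ twice q j) ×
        InC q F α x 0 × InC q F α x i × InC q F α x j ×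
        InC q F α x (twice q i) × InC q F α x (twice q j))
mainTheorem16 q q-oddPrimePower F α α-primitive with 2≤oddPrimePower q-oddPrimePower
... | s≤s (s≤s {n = p′} _) =
  λ (x , i , j , _ , i<m , j<m , 0≢i , 0≢j , _ , _ , _ , _ , _ , _ , _ , 2i≢2j , C₀ , Cᵢ , Cⱼ , C₂ᵢ , C₂ⱼ) →
    2i≢2j (Tr₂[α^x*β]≈0⇒twice≡ x i j
      (InC⇒Tr₂[α^x*β]≈0 x 0≢i i<m C₀ Cᵢ C₂ᵢ)
      (InC⇒Tr₂[α^x*β]≈0 x 0≢j j<m C₀ Cⱼ C₂ⱼ))
  where open PrimitiveTrace (suc p′) F α-primitive
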